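{- Let $(L;\wedge,\vee,^{\Delta},^{\nabla},0,1)$ be a weakly dicomplemented lattice. For $F$ a filter of $L$ let $F^{\star}=\{a\in L\mid x^{\Delta}\le a\ \forall x\in F\}$, let $F_p(L)=\{[a)\mid a\in L\}$ be the set of principal filters $[a)=\{x\in L\mid a\le x\}$, and let $\Lambda(L)=\{[a)^{\star}\mid a\in L\}$. (1) $(F_p(L);\cap,\vee,^{\star},\{1\},L)$ (with $\vee$ the join of filters) is a dual weakly complemented lattice, and it is dually isomorphic to the weakly complemented lattice $(L;\vee,\wedge,^{\Delta},0,1)$ via $a\mapsto[a)$; that is, this map is a bijection with $[a\vee b)=[a)\cap[b)$, $[a\wedge b)=[a)\vee[b)$ and $[a^{\Delta})=[a)^{\star}$. (2) $\Lambda(L)$, ordered by inclusion, with meet $\cap$, join the join in the poset $(\Lambda(L),\subseteq)$, and unary operation $^{\star}$, is an ortholattice with least element $\{1\}$ and greatest element $L$, and it is isomorphic (as an ortholattice) to $(\overline{S}(L);\overline{\sqcap},\vee,^{\Delta},0,1)$.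
   Context: A weakly dicomplemented lattice (WDL) is an algebra $(L;\wedge,\vee,^{\Delta},^{\nabla},0,1)$ such that $(L;\wedge,\vee,0,1)$ is a bounded lattice and, for all $x,y\in L$: $x^{\Delta\Delta}\le x$; $x\le y\Rightarrow y^{\Delta}\le x^{\Delta}$; $(x\wedge y)\vee(x\wedge y^{\Delta})=x$; $x^{\nabla\nabla}\ge x$; $x\le y\Rightarrow y^{\nabla}\le x^{\nabla}$; $(x\vee y)\wedge(x\vee y^{\nabla})=x$. A weakly complemented lattice is a bounded lattice with a unary operation satisfying the first three axioms; a dual weakly complemented lattice is a bounded lattice with a unary operation satisfying the last three. A filter is a nonempty upward closed subset closed under $\wedge$. $\overline{S}(L)=\{x\in L\mid x^{\Delta\Delta}=x\}$ and $x\,\overline{\sqcap}\,y=(x^{\Delta}\vee y^{\Delta})^{\Delta}$. An ortholattice is a bounded lattice with a unary operation $^{\perp}$ that is order-reversing, involutive ($a^{\perp\perp}=a$), and satisfies $a\vee a^{\perp}=1$, $a\wedge a^{\perp}=0$. -}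

module Defs where

open import Level using (Level; suc; _⊔_; Lift)
open import Data.Unit.Polymorphic using (⊤)
open import Data.Product using (Σ; Σ-syntax; ∃; ∃-syntax; _×_; _,_; proj₁; proj₂)
open import Relation.Binary using (Rel)
open import Relation.Binary.Lattice.Structures using (IsBoundedLattice)
open import Relation.Binary.Lattice.Bundles using (BoundedLattice)
open import Relation.Unary using (Pred; _⊆_; _≐_; _∩_)

record WDL (ℓ : Level) : Set (suc ℓ) where
  field
    boundedLattice : BoundedLattice ℓ ℓ ℓ
  open BoundedLattice boundedLattice public
    renaming (⊤ to 𝟙; ⊥ to 𝟘)
  field
    _ᐞ : Carrier → Carrier
    _ᐁ : Carrier → Carrier
    ΔΔ-≤    : ∀ x → (x ᐞ) ᐞ ≤ x
    Δ-anti  : ∀ {x y} → x ≤ y → y ᐞ ≤ x ᐞ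
    Δ-split : ∀ x y → (x ∧ y) ∨ (x ∧ (y ᐞ)) ≈ x
    ∇∇-≥    : ∀ x → x ≤ (x ᐁ) ᐁ
    ∇-anti  : ∀ {x y} → x ≤ y → y ᐁ ≤ x ᐁ
    ∇-split : ∀ x y → (x ∨ y) ∧ (x ∨ (y ᐁ)) ≈ x

record Sig (a ℓ : Level) : Set (suc (a ⊔ ℓ)) where
  field
    Car  : Set a
    _≈ₛ_ : Rel Car ℓ
    _≤ₛ_ : Rel Car ℓ
    _⊓ₛ_ : Car → Car → Car
    _⊔ₛ_ : Car → Car → Car
    _′ₛ  : Car → Car
    botₛ : Car
    topₛ : Car

record IsDualWeaklyComplemented {a ℓ} (S : Sig a ℓ) : Set (a ⊔ ℓ) where
  open Sig S
  field
    isBoundedLattice : IsBoundedLattice _≈ₛ_ _≤ₛ_ _⊔ₛ_ _⊓ₛ_ topₛ botₛ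
    ′′-≥    : ∀ x → x ≤ₛ ((x ′ₛ) ′ₛ)
    ′-anti  : ∀ {x y} → x ≤ₛ y → (y ′ₛ) ≤ₛ (x ′ₛ)
    ′-split : ∀ x y → ((x ⊔ₛ y) ⊓ₛ (x ⊔ₛ (y ′ₛ))) ≈ₛ x

record IsOrtholattice {a ℓ} (S : Sig a ℓ) : Set (a ⊔ ℓ) where
  open Sig S
  field
    isBoundedLattice : IsBoundedLattice _≈ₛ_ _≤ₛ_ _⊔ₛ_ _⊓ₛ_ topₛ botₛ
    ′-anti   : ∀ {x y} → x ≤ₛ y → (y ′ₛ) ≤ₛ (x ′ₛ)
    ′-invol  : ∀ x → ((x ′ₛ) ′ₛ) ≈ₛ x
    ′-join   : ∀ x → (x ⊔ₛ (x ′ₛ)) ≈ₛ topₛ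
    ′-meet   : ∀ x → (x ⊓ₛ (x ′ₛ)) ≈ₛ botₛ

record IsOrthoIso {a b ℓ} (S : Sig a ℓ) (T : Sig b ℓ)
                  (f : Sig.Car S → Sig.Car T) : Set (a ⊔ b ⊔ ℓ) where
  open Sig S
  open Sig T renaming (_≈ₛ_ to _≈ₜ_; _⊓ₛ_ to _⊓ₜ_; _⊔ₛ_ to _⊔ₜ_; _′ₛ to _′ₜ;
                       botₛ to botₜ; topₛ to topₜ)
  field
    cong      : ∀ {x y} → x ≈ₛ y → f x ≈ₜ f y
    injective : ∀ {x y} → f x ≈ₜ f y → x ≈ₛ y
    surjective : ∀ z → ∃[ x ] (f x ≈ₜ z)
    pres-⊓    : ∀ x y → f (x ⊓ₛ y) ≈ₜ (f x ⊓ₜ f y)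
    pres-⊔    : ∀ x y → f (x ⊔ₛ y) ≈ₜ (f x ⊔ₜ f y)
    pres-′    : ∀ x → f (x ′ₛ) ≈ₜ (f x ′ₜ)
    pres-bot  : f botₛ ≈ₜ botₜ
    pres-top  : f topₛ ≈ₜ topₜ

module _ {ℓ} (L : WDL ℓ) where
  open WDL L

  ⟦_⟫ : Carrier → Pred Carrier ℓ
  ⟦ a ⟫ = λ x → a ≤ x

  _⋆ : Pred Carrier ℓ → Pred Carrier ℓ
  F ⋆ = λ a → ∀ x → F x → (x ᐞ) ≤ a

  -- join of two filters: the filter generated by F ∪ G
  _∨F_ : Pred Carrier ℓ → Pred Carrier ℓ → Pred Carrier ℓ
  F ∨F G = λ x → ∃[ f ] ∃[ g ] (F f × G g × (f ∧ g) ≤ x)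

  ｛𝟙｝ : Pred Carrier ℓ
  ｛𝟙｝ = λ x → x ≈ 𝟙

  Whole : Pred Carrier ℓ
  Whole = λ _ → ⊤

  IsPrincipal : Pred Carrier ℓ → Set ℓ
  IsPrincipal F = ∃[ a ] (F ≐ ⟦ a ⟫)

  Fp : Set (suc ℓ)
  Fp = Σ[ F ∈ Pred Carrier ℓ ] IsPrincipal F

  InΛ : Pred Carrier ℓ → Set ℓ
  InΛ F = ∃[ a ] (F ≐ (⟦ a ⟫ ⋆))

  Λ : Set (suc ℓ)
  Λ = Σ[ F ∈ Pred Carrier ℓ ] InΛ F

  S̄ : Set ℓ
  S̄ = Σ[ x ∈ Carrier ] ((x ᐞ) ᐞ ≈ x)

  _⊓̄_ : Carrier → Carrier → Carrier
  x ⊓̄ y = ((x ᐞ) ∨ (y ᐞ)) ᐞ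

  record FpClosed : Set (suc ℓ) where
    field
      ∩-cl  : ∀ {F G} → IsPrincipal F → IsPrincipal G → IsPrincipal (F ∩ G)
      ∨-cl  : ∀ {F G} → IsPrincipal F → IsPrincipal G → IsPrincipal (F ∨F G)
      ⋆-cl  : ∀ {F} → IsPrincipal F → IsPrincipal (F ⋆)
      𝟙-cl  : IsPrincipal ｛𝟙｝
      L-cl  : IsPrincipal Whole

  FpSig : FpClosed → Sig (suc ℓ) ℓ
  FpSig cl = record
    { Car  = Fp
    ; _≈ₛ_ = λ F G → proj₁ F ≐ proj₁ G
    ; _≤ₛ_ = λ F G → proj₁ F ⊆ proj₁ G
    ; _⊓ₛ_ = λ F G → (proj₁ F ∩ proj₁ G) , ∩-cl (proj₂ F) (proj₂ G)
    ; _⊔ₛ_ = λ F G → (proj₁ F ∨F proj₁ G) , ∨-cl (proj₂ F) (proj₂ G)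
    ; _′ₛ  = λ F → (proj₁ F ⋆) , ⋆-cl (proj₂ F)
    ; botₛ = ｛𝟙｝ , 𝟙-cl
    ; topₛ = Whole , L-cl
    }
    where open FpClosed cl

  record ΛClosed : Set (suc ℓ) where
    field
      ∩-cl  : ∀ {F G} → InΛ F → InΛ G → InΛ (F ∩ G)
      ⋆-cl  : ∀ {F} → InΛ F → InΛ (F ⋆)
      𝟙-cl  : InΛ ｛𝟙｝
      L-cl  : InΛ Whole

  ΛSig : ΛClosed → (Λ → Λ → Λ) → Sig (suc ℓ) ℓ
  ΛSig cl join = record
    { Car  = Λ
    ; _≈ₛ_ = λ F G → proj₁ F ≐ proj₁ G
    ; _≤ₛ_ = λ F G → proj₁ F ⊆ proj₁ G
    ; _⊓ₛ_ = λ F G → (proj₁ F ∩ proj₁ G) , ∩-cl (proj₂ F) (proj₂ G)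
    ; _⊔ₛ_ = join
    ; _′ₛ  = λ F → (proj₁ F ⋆) , ⋆-cl (proj₂ F)
    ; botₛ = ｛𝟙｝ , 𝟙-cl
    ; topₛ = Whole , L-cl
    }
    where open ΛClosed cl

  record S̄Closed : Set ℓ where
    field
      ⊓̄-cl : ∀ {x y} → (x ᐞ) ᐞ ≈ x → (y ᐞ) ᐞ ≈ y → ((x ⊓̄ y) ᐞ) ᐞ ≈ (x ⊓̄ y)
      ∨-cl : ∀ {x y} → (x ᐞ) ᐞ ≈ x → (y ᐞ) ᐞ ≈ y → ((x ∨ y) ᐞ) ᐞ ≈ (x ∨ y)
      ᐞ-cl : ∀ {x} → (x ᐞ) ᐞ ≈ x → (((x ᐞ) ᐞ) ᐞ) ≈ (x ᐞ)
      𝟘-cl : (𝟘 ᐞ) ᐞ ≈ 𝟘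
      𝟙-cl : (𝟙 ᐞ) ᐞ ≈ 𝟙

  S̄Sig : S̄Closed → Sig ℓ ℓ
  S̄Sig cl = record
    { Car  = S̄
    ; _≈ₛ_ = λ x y → proj₁ x ≈ proj₁ y
    ; _≤ₛ_ = λ x y → proj₁ x ≤ proj₁ y
    ; _⊓ₛ_ = λ x y → (proj₁ x ⊓̄ proj₁ y) , ⊓̄-cl (proj₂ x) (proj₂ y)
    ; _⊔ₛ_ = λ x y → (proj₁ x ∨ proj₁ y) , ∨-cl (proj₂ x) (proj₂ y)
    ; _′ₛ  = λ x → (proj₁ x ᐞ) , ᐞ-cl (proj₂ x)
    ; botₛ = 𝟘 , 𝟘-cl
    ; topₛ = 𝟙 , 𝟙-cl
    }
    where open S̄Closed cl

{-# OPTIONS --safe #-}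
module Submission where

-- The map a ↦ [a) is an order-reversing bijection from L onto its principal
-- filters which turns ∨ into ∩, ∧ into the join of filters and, since
-- [a)⋆ = [a^Δ), Δ into ⋆; so every law of F_p(L) is a law of the weakly
-- complemented lattice L read upside down. For the same reason Λ(L) consists
-- of the filters [s) with s in the skeleton S̄(L) = {x | x^ΔΔ = x}, on which
-- x ↦ [x)⋆ turns ⊓̄ into ∩. The skeleton is an ortholattice: x ∨ x^Δ = 1 is the
-- axiom (x ∧ y) ∨ (x ∧ y^Δ) = x at x = 1, and x ⊓̄ x^Δ = (x^Δ ∨ x^ΔΔ)^Δ = 1^Δ = 0.

open import Defs hiding (⟦_⟫; _⋆; _∨F_; ｛𝟙｝; Whole; _⊓̄_)
open import Level using (suc; _⊔_)
open import Data.Product using (Σ-syntax; ∃-syntax; _×_; _,_; proj₁; proj₂)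
open import Function.Base using (_on_)
open import Relation.Unary using (Pred; _⊆_; _≐_; _∩_)
open import Relation.Unary.Algebra using (∩-cong)
open import Relation.Unary.Properties using (≐-refl; ≐-sym; ≐-trans)
open import Relation.Unary.Relation.Binary.Equality using (≐-setoid)
open import Relation.Unary.Relation.Binary.Subset using (⊆-isPartialOrder)
open import Relation.Binary.Lattice.Bundles using (BoundedLattice)
open import Relation.Binary.Lattice.Definitions using (Supremum; Infimum)
open import Relation.Binary.Lattice.Structures using (IsBoundedLattice)
import Relation.Binary.Construct.On as On
import Relation.Binary.Lattice.Properties.JoinSemilattice as JoinSemilatticeProperties
import Relation.Binary.Reasoning.PartialOrder as PartialOrderReasoning
import Relation.Binary.Reasoning.Setoid as SetoidReasoning

record WeaklyComplementedLattice c ℓ₁ ℓ₂ : Set (suc (c ⊔ ℓ₁ ⊔ ℓ₂)) where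
  field
    boundedLattice : BoundedLattice c ℓ₁ ℓ₂
  open BoundedLattice boundedLattice public
  field
    _ᐞ      : Carrier → Carrier
    ΔΔ-≤    : ∀ x → x ᐞ ᐞ ≤ x
    Δ-anti  : ∀ {x y} → x ≤ y → y ᐞ ≤ x ᐞ
    Δ-split : ∀ x y → (x ∧ y) ∨ (x ∧ y ᐞ) ≈ x

weaklyComplementedLattice : ∀ {ℓ} → WDL ℓ → WeaklyComplementedLattice ℓ ℓ ℓ
weaklyComplementedLattice L = record
  { boundedLattice = boundedLattice
  ; _ᐞ            = _ᐞ
  ; ΔΔ-≤          = ΔΔ-≤
  ; Δ-anti        = Δ-anti
  ; Δ-split       = Δ-split
  }
  where open WDL L

module WeaklyComplementedLatticeProperties
  {c ℓ₁ ℓ₂} (W : WeaklyComplementedLattice c ℓ₁ ℓ₂) where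

  open WeaklyComplementedLattice W
  open JoinSemilatticeProperties joinSemilattice using (∨-monotonic; x≤y⇒x∨y≈y)
  open PartialOrderReasoning poset

  private
    variable
      x y z : Carrier

  Skeletal : Carrier → Set ℓ₁
  Skeletal x = x ᐞ ᐞ ≈ x

  infixr 7 _⊓̄_
  _⊓̄_ : Carrier → Carrier → Carrier
  x ⊓̄ y = (x ᐞ ∨ y ᐞ) ᐞ

  Δ-cong : x ≈ y → x ᐞ ≈ y ᐞ
  Δ-cong x≈y = antisym (Δ-anti (reflexive (Eq.sym x≈y))) (Δ-anti (reflexive x≈y))

  ΔΔ-mono : x ≤ y → x ᐞ ᐞ ≤ y ᐞ ᐞ
  ΔΔ-mono x≤y = Δ-anti (Δ-anti x≤y)

  Δ-skeletal : ∀ x → Skeletal (x ᐞ)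
  Δ-skeletal x = antisym (ΔΔ-≤ (x ᐞ)) (Δ-anti (ΔΔ-≤ x))

  ∨-skeletal : Skeletal x → Skeletal y → Skeletal (x ∨ y)
  ∨-skeletal {x} {y} x-sk y-sk =
    antisym (ΔΔ-≤ (x ∨ y)) (∨-least (below x-sk (x≤x∨y x y)) (below y-sk (y≤x∨y x y)))
    where
      below : ∀ {u} → Skeletal u → u ≤ x ∨ y → u ≤ (x ∨ y) ᐞ ᐞ
      below {u} u-sk u≤x∨y = begin
        u                ≈⟨ u-sk ⟨
        u ᐞ ᐞ            ≤⟨ ΔΔ-mono u≤x∨y ⟩
        (x ∨ y) ᐞ ᐞ      ∎

  x∨xΔ≈⊤ : ∀ x → x ∨ x ᐞ ≈ ⊤
  x∨xΔ≈⊤ x = antisym (maximum _) (begin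
    ⊤                        ≈⟨ Δ-split ⊤ x ⟨
    (⊤ ∧ x) ∨ (⊤ ∧ x ᐞ)      ≤⟨ ∨-monotonic (x∧y≤y ⊤ x) (x∧y≤y ⊤ (x ᐞ)) ⟩
    x ∨ x ᐞ                  ∎)

  ⊥Δ≈⊤ : ⊥ ᐞ ≈ ⊤
  ⊥Δ≈⊤ = Eq.trans (Eq.sym (x≤y⇒x∨y≈y (minimum (⊥ ᐞ)))) (x∨xΔ≈⊤ ⊥)

  ⊤Δ≈⊥ : ⊤ ᐞ ≈ ⊥
  ⊤Δ≈⊥ = antisym (begin
    ⊤ ᐞ       ≤⟨ Δ-anti (maximum (⊥ ᐞ)) ⟩
    ⊥ ᐞ ᐞ     ≤⟨ ΔΔ-≤ ⊥ ⟩
    ⊥         ∎) (minimum _)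

  ⊥-skeletal : Skeletal ⊥
  ⊥-skeletal = Eq.trans (Δ-cong ⊥Δ≈⊤) ⊤Δ≈⊥

  ⊤-skeletal : Skeletal ⊤
  ⊤-skeletal = Eq.trans (Δ-cong ⊤Δ≈⊥) ⊥Δ≈⊤

  x⊓̄y≤x : Skeletal x → x ⊓̄ y ≤ x
  x⊓̄y≤x {x} {y} x-sk = begin
    (x ᐞ ∨ y ᐞ) ᐞ    ≤⟨ Δ-anti (x≤x∨y _ _) ⟩
    x ᐞ ᐞ            ≈⟨ x-sk ⟩
    x                ∎

  x⊓̄y≤y : Skeletal y → x ⊓̄ y ≤ y
  x⊓̄y≤y {y} {x} y-sk = begin
    (x ᐞ ∨ y ᐞ) ᐞ    ≤⟨ Δ-anti (y≤x∨y _ _) ⟩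
    y ᐞ ᐞ            ≈⟨ y-sk ⟩
    y                ∎

  ⊓̄-greatest : Skeletal z → z ≤ x → z ≤ y → z ≤ x ⊓̄ y
  ⊓̄-greatest {z} {x} {y} z-sk z≤x z≤y = begin
    z                ≈⟨ z-sk ⟨
    z ᐞ ᐞ            ≤⟨ Δ-anti (∨-least (Δ-anti z≤x) (Δ-anti z≤y)) ⟩
    (x ᐞ ∨ y ᐞ) ᐞ    ∎

  x⊓̄xΔ≈⊥ : ∀ x → x ⊓̄ x ᐞ ≈ ⊥
  x⊓̄xΔ≈⊥ x = Eq.trans (Δ-cong (x∨xΔ≈⊤ (x ᐞ))) ⊤Δ≈⊥

module PrincipalFilters {ℓ} (L : WDL ℓ) where

  open WDL L
  open WeaklyComplementedLatticeProperties (weaklyComplementedLattice L)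
  open SetoidReasoning (≐-setoid Carrier ℓ)

  private
    variable
      a b : Carrier
      F F′ G G′ : Pred Carrier ℓ

    ⟦_⟫ : Carrier → Pred Carrier ℓ
    ⟦_⟫ = Defs.⟦_⟫ L

    _⋆ : Pred Carrier ℓ → Pred Carrier ℓ
    _⋆ = Defs._⋆ L

    _∨F_ : Pred Carrier ℓ → Pred Carrier ℓ → Pred Carrier ℓ
    _∨F_ = Defs._∨F_ L

    ｛𝟙｝ Whole : Pred Carrier ℓ
    ｛𝟙｝ = Defs.｛𝟙｝ L
    Whole = Defs.Whole L

  ⟦⟫-antitone : b ≤ a → ⟦ a ⟫ ⊆ ⟦ b ⟫
  ⟦⟫-antitone b≤a a≤x = trans b≤a a≤x

  ⟦⟫-cong : a ≈ b → ⟦ a ⟫ ≐ ⟦ b ⟫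
  ⟦⟫-cong a≈b = ⟦⟫-antitone (reflexive (Eq.sym a≈b)) , ⟦⟫-antitone (reflexive a≈b)

  ⟦⟫-injective : ⟦ a ⟫ ≐ ⟦ b ⟫ → a ≈ b
  ⟦⟫-injective (a↑⊆b↑ , b↑⊆a↑) = antisym (b↑⊆a↑ refl) (a↑⊆b↑ refl)

  ⟦⟫-∨ : ∀ a b → ⟦ a ∨ b ⟫ ≐ ⟦ a ⟫ ∩ ⟦ b ⟫
  ⟦⟫-∨ a b = (λ a∨b≤x → trans (x≤x∨y a b) a∨b≤x , trans (y≤x∨y a b) a∨b≤x)
           , (λ (a≤x , b≤x) → ∨-least a≤x b≤x)

  ⟦⟫-∧ : ∀ a b → ⟦ a ∧ b ⟫ ≐ ⟦ a ⟫ ∨F ⟦ b ⟫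
  ⟦⟫-∧ a b = (λ a∧b≤x → a , b , refl , refl , a∧b≤x)
           , (λ (f , g , a≤f , b≤g , f∧g≤x) →
                trans (∧-greatest (trans (x∧y≤x a b) a≤f) (trans (x∧y≤y a b) b≤g)) f∧g≤x)

  ⟦⟫-Δ : ∀ a → ⟦ a ᐞ ⟫ ≐ ⟦ a ⟫ ⋆
  ⟦⟫-Δ a = (λ aΔ≤y x a≤x → trans (Δ-anti a≤x) aΔ≤y) , (λ a↑⋆y → a↑⋆y a refl)

  ⟦𝟙⟫≐｛𝟙｝ : ⟦ 𝟙 ⟫ ≐ ｛𝟙｝
  ⟦𝟙⟫≐｛𝟙｝ = (λ 𝟙≤x → antisym (maximum _) 𝟙≤x) , (λ x≈𝟙 → reflexive (Eq.sym x≈𝟙))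

  ⟦𝟘⟫≐Whole : ⟦ 𝟘 ⟫ ≐ Whole
  ⟦𝟘⟫≐Whole = _ , (λ _ → minimum _)

  ⋆-antitone : F ⊆ G → G ⋆ ⊆ F ⋆
  ⋆-antitone F⊆G G⋆y x x∈F = G⋆y x (F⊆G x∈F)

  ⋆-cong : F ≐ G → F ⋆ ≐ G ⋆
  ⋆-cong (F⊆G , G⊆F) = ⋆-antitone G⊆F , ⋆-antitone F⊆G

  ⋆⋆-extensive : F ⊆ F ⋆ ⋆
  ⋆⋆-extensive {x = x} x∈F y F⋆y = trans (Δ-anti (F⋆y x x∈F)) (ΔΔ-≤ x)

  ⋆-principal : F ≐ ⟦ a ⟫ → F ⋆ ≐ ⟦ a ᐞ ⟫
  ⋆-principal {a = a} F≐a↑ = ≐-trans (⋆-cong F≐a↑) (≐-sym (⟦⟫-Δ a))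

  ∨F-cong : F ≐ F′ → G ≐ G′ → F ∨F G ≐ F′ ∨F G′
  ∨F-cong (F⊆F′ , F′⊆F) (G⊆G′ , G′⊆G) =
      (λ (f , g , f∈F , g∈G , f∧g≤x) → f , g , F⊆F′ f∈F , G⊆G′ g∈G , f∧g≤x)
    , (λ (f , g , f∈F′ , g∈G′ , f∧g≤x) → f , g , F′⊆F f∈F′ , G′⊆G g∈G′ , f∧g≤x)

  module _ {c} {A : Set c} (filter : A → Pred Carrier ℓ) (generator : A → Carrier)
           (generates : ∀ F → filter F ≐ ⟦ generator F ⟫) where

    ≥⇒⊆ : ∀ {F G} → generator G ≤ generator F → filter F ⊆ filter G
    ≥⇒⊆ {F} {G} gG≤gF x∈F = proj₂ (generates G) (⟦⟫-antitone gG≤gF (proj₁ (generates F) x∈F))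

    ⊆⇒≥ : ∀ {F G} → filter F ⊆ filter G → generator G ≤ generator F
    ⊆⇒≥ {F} {G} F⊆G = proj₁ (generates G) (F⊆G (proj₂ (generates F) refl))

    ⊆-isBoundedLattice : ∀ {_⊔_ _⊓_ : A → A → A} {⊤ᴬ ⊥ᴬ : A} →
      Infimum (_≤_ on generator) _⊔_ →
      (∀ F G → filter (F ⊓ G) ≐ filter F ∩ filter G) →
      filter ⊤ᴬ ≐ Whole → filter ⊥ᴬ ≐ ｛𝟙｝ →
      IsBoundedLattice (_≐_ on filter) (_⊆_ on filter) _⊔_ _⊓_ ⊤ᴬ ⊥ᴬ
    ⊆-isBoundedLattice {_⊔_} {_⊓_} {⊤ᴬ} {⊥ᴬ} glb ⊓-is-∩ ⊤-is-Whole ⊥-is-｛𝟙｝ = record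
      { isLattice = record
        { isPartialOrder = On.isPartialOrder filter ⊆-isPartialOrder
        ; supremum       = ⊔-lub
        ; infimum        = ⊓-glb
        }
      ; maximum = λ _ _ → proj₂ ⊤-is-Whole _
      ; minimum = λ F x∈⊥ → proj₂ (generates F) (trans (maximum _)
                             (reflexive (Eq.sym (proj₁ ⊥-is-｛𝟙｝ x∈⊥))))
      }
      where
        ⊔-lub : Supremum (_⊆_ on filter) _⊔_
        ⊔-lub F G = let lb₁ , lb₂ , greatest = glb F G in
          ≥⇒⊆ lb₁ , ≥⇒⊆ lb₂ , λ H F⊆H G⊆H → ≥⇒⊆ (greatest H (⊆⇒≥ F⊆H) (⊆⇒≥ G⊆H))

        ⊓-glb : Infimum (_⊆_ on filter) _⊓_
        ⊓-glb F G = (λ x∈F⊓G → proj₁ (proj₁ (⊓-is-∩ F G) x∈F⊓G))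
                  , (λ x∈F⊓G → proj₂ (proj₁ (⊓-is-∩ F G) x∈F⊓G))
                  , λ H H⊆F H⊆G x∈H → proj₂ (⊓-is-∩ F G) (H⊆F x∈H , H⊆G x∈H)

  Fp-closed : FpClosed L
  Fp-closed = record
    { ∩-cl = λ (a , F≐a↑) (b , G≐b↑) → a ∨ b , ≐-trans (∩-cong F≐a↑ G≐b↑) (≐-sym (⟦⟫-∨ a b))
    ; ∨-cl = λ (a , F≐a↑) (b , G≐b↑) → a ∧ b , ≐-trans (∨F-cong F≐a↑ G≐b↑) (≐-sym (⟦⟫-∧ a b))
    ; ⋆-cl = λ (a , F≐a↑) → a ᐞ , ⋆-principal F≐a↑
    ; 𝟙-cl = 𝟙 , ≐-sym ⟦𝟙⟫≐｛𝟙｝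
    ; L-cl = 𝟘 , ≐-sym ⟦𝟘⟫≐Whole
    }

  generatorᶠ : Fp L → Carrier
  generatorᶠ F = proj₁ (proj₂ F)

  generatesᶠ : ∀ F → proj₁ F ≐ ⟦ generatorᶠ F ⟫
  generatesᶠ F = proj₂ (proj₂ F)

  Fp-isDualWeaklyComplemented : IsDualWeaklyComplemented (FpSig L Fp-closed)
  Fp-isDualWeaklyComplemented = record
    { isBoundedLattice = ⊆-isBoundedLattice proj₁ generatorᶠ generatesᶠ
                           glb (λ _ _ → ≐-refl) ≐-refl ≐-refl
    ; ′′-≥             = λ _ → ⋆⋆-extensive
    ; ′-anti           = ⋆-antitone
    ; ′-split          = split
    }
    where
      open Sig (FpSig L Fp-closed)

      glb : Infimum (_≤_ on generatorᶠ) _⊔ₛ_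
      glb F G = x∧y≤x _ _ , x∧y≤y _ _ , λ _ → ∧-greatest

      split : ∀ F G → proj₁ ((F ⊔ₛ G) ⊓ₛ (F ⊔ₛ (G ′ₛ))) ≐ proj₁ F
      split F G = let a = generatorᶠ F ; b = generatorᶠ G in begin
        proj₁ ((F ⊔ₛ G) ⊓ₛ (F ⊔ₛ (G ′ₛ)))   ≈⟨ generatesᶠ ((F ⊔ₛ G) ⊓ₛ (F ⊔ₛ (G ′ₛ))) ⟩
        ⟦ (a ∧ b) ∨ (a ∧ b ᐞ) ⟫            ≈⟨ ⟦⟫-cong (Δ-split a b) ⟩
        ⟦ a ⟫                              ≈⟨ generatesᶠ F ⟨
        proj₁ F                            ∎

  Λ[_] : Carrier → Λ L
  Λ[ a ] = ⟦ a ⟫ ⋆ , a , ≐-refl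

  ⟦⟫⋆-∩ : ∀ a b → ⟦ a ⟫ ⋆ ∩ ⟦ b ⟫ ⋆ ≐ ⟦ a ⊓̄ b ⟫ ⋆
  ⟦⟫⋆-∩ a b = begin
    ⟦ a ⟫ ⋆ ∩ ⟦ b ⟫ ⋆              ≈⟨ ∩-cong (⟦⟫-Δ a) (⟦⟫-Δ b) ⟨
    ⟦ a ᐞ ⟫ ∩ ⟦ b ᐞ ⟫              ≈⟨ ⟦⟫-∨ (a ᐞ) (b ᐞ) ⟨
    ⟦ a ᐞ ∨ b ᐞ ⟫                  ≈⟨ ⟦⟫-cong (∨-skeletal (Δ-skeletal a) (Δ-skeletal b)) ⟨
    ⟦ (a ᐞ ∨ b ᐞ) ᐞ ᐞ ⟫            ≈⟨ ⟦⟫-Δ (a ⊓̄ b) ⟩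
    ⟦ a ⊓̄ b ⟫ ⋆                    ∎

  ｛𝟙｝≐⟦𝟘⟫⋆ : ｛𝟙｝ ≐ ⟦ 𝟘 ⟫ ⋆
  ｛𝟙｝≐⟦𝟘⟫⋆ = begin
    ｛𝟙｝       ≈⟨ ⟦𝟙⟫≐｛𝟙｝ ⟨
    ⟦ 𝟙 ⟫       ≈⟨ ⟦⟫-cong ⊥Δ≈⊤ ⟨
    ⟦ 𝟘 ᐞ ⟫     ≈⟨ ⟦⟫-Δ 𝟘 ⟩
    ⟦ 𝟘 ⟫ ⋆     ∎

  Whole≐⟦𝟙⟫⋆ : Whole ≐ ⟦ 𝟙 ⟫ ⋆
  Whole≐⟦𝟙⟫⋆ = begin
    Whole       ≈⟨ ⟦𝟘⟫≐Whole ⟨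
    ⟦ 𝟘 ⟫       ≈⟨ ⟦⟫-cong ⊤Δ≈⊥ ⟨
    ⟦ 𝟙 ᐞ ⟫     ≈⟨ ⟦⟫-Δ 𝟙 ⟩
    ⟦ 𝟙 ⟫ ⋆     ∎

  Λ-closed : ΛClosed L
  Λ-closed = record
    { ∩-cl = λ (a , F≐a↑⋆) (b , G≐b↑⋆) → a ⊓̄ b , ≐-trans (∩-cong F≐a↑⋆ G≐b↑⋆) (⟦⟫⋆-∩ a b)
    ; ⋆-cl = λ (a , F≐a↑⋆) → a ᐞ , ⋆-cong (≐-trans F≐a↑⋆ (≐-sym (⟦⟫-Δ a)))
    ; 𝟙-cl = 𝟘 , ｛𝟙｝≐⟦𝟘⟫⋆
    ; L-cl = 𝟙 , Whole≐⟦𝟙⟫⋆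
    }

  generatorᴧ : Λ L → Carrier
  generatorᴧ F = proj₁ (proj₂ F) ᐞ

  generatesᴧ : ∀ F → proj₁ F ≐ ⟦ generatorᴧ F ⟫
  generatesᴧ (_ , a , F≐a↑⋆) = ≐-trans F≐a↑⋆ (≐-sym (⟦⟫-Δ a))

  generatorᴧ-skeletal : ∀ F → Skeletal (generatorᴧ F)
  generatorᴧ-skeletal F = Δ-skeletal (proj₁ (proj₂ F))

  -- Inclusion reverses the order of generators, so the join is generated by their ⊓̄:
  -- generatorᴧ (Λ-join F G) reduces to generatorᴧ F ⊓̄ generatorᴧ G.
  Λ-join : Λ L → Λ L → Λ L
  Λ-join F G = Λ[ generatorᴧ F ᐞ ∨ generatorᴧ G ᐞ ]

  Λ-isOrtholattice : IsOrtholattice (ΛSig L Λ-closed Λ-join)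
  Λ-isOrtholattice = record
    { isBoundedLattice = ⊆-isBoundedLattice proj₁ generatorᴧ generatesᴧ
                           glb (λ _ _ → ≐-refl) ≐-refl ≐-refl
    ; ′-anti           = ⋆-antitone
    ; ′-invol          = invol
    ; ′-join           = join
    ; ′-meet           = meet
    }
    where
      open Sig (ΛSig L Λ-closed Λ-join)

      glb : Infimum (_≤_ on generatorᴧ) Λ-join
      glb F G = x⊓̄y≤x (generatorᴧ-skeletal F) , x⊓̄y≤y (generatorᴧ-skeletal G)
              , λ H → ⊓̄-greatest (generatorᴧ-skeletal H)

      invol : ∀ F → proj₁ F ⋆ ⋆ ≐ proj₁ F
      invol F = let g = generatorᴧ F in begin
        proj₁ F ⋆ ⋆     ≈⟨ ⋆-principal (⋆-principal (generatesᴧ F)) ⟩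
        ⟦ g ᐞ ᐞ ⟫       ≈⟨ ⟦⟫-cong (generatorᴧ-skeletal F) ⟩
        ⟦ g ⟫           ≈⟨ generatesᴧ F ⟨
        proj₁ F         ∎

      join : ∀ F → proj₁ (F ⊔ₛ (F ′ₛ)) ≐ Whole
      join F = let g = generatorᴧ F in begin
        proj₁ (F ⊔ₛ (F ′ₛ))   ≈⟨ generatesᴧ (F ⊔ₛ (F ′ₛ)) ⟩
        ⟦ g ⊓̄ g ᐞ ⟫           ≈⟨ ⟦⟫-cong (x⊓̄xΔ≈⊥ g) ⟩
        ⟦ 𝟘 ⟫                 ≈⟨ ⟦𝟘⟫≐Whole ⟩
        Whole                 ∎

      meet : ∀ F → proj₁ F ∩ proj₁ F ⋆ ≐ ｛𝟙｝
      meet F = let g = generatorᴧ F in begin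
        proj₁ F ∩ proj₁ F ⋆   ≈⟨ ∩-cong (generatesᴧ F) (⋆-principal (generatesᴧ F)) ⟩
        ⟦ g ⟫ ∩ ⟦ g ᐞ ⟫       ≈⟨ ⟦⟫-∨ g (g ᐞ) ⟨
        ⟦ g ∨ g ᐞ ⟫           ≈⟨ ⟦⟫-cong (x∨xΔ≈⊤ g) ⟩
        ⟦ 𝟙 ⟫                 ≈⟨ ⟦𝟙⟫≐｛𝟙｝ ⟩
        ｛𝟙｝                 ∎

  S̄-closed : S̄Closed L
  S̄-closed = record
    { ⊓̄-cl = λ {x} {y} _ _ → Δ-skeletal (x ᐞ ∨ y ᐞ)
    ; ∨-cl = ∨-skeletal
    ; ᐞ-cl = λ {x} _ → Δ-skeletal x
    ; 𝟘-cl = ⊥-skeletal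
    ; 𝟙-cl = ⊤-skeletal
    }

  S̄-isOrtholattice : IsOrtholattice (S̄Sig L S̄-closed)
  S̄-isOrtholattice = record
    { isBoundedLattice = record
      { isLattice = record
        { isPartialOrder = On.isPartialOrder proj₁ isPartialOrder
        ; supremum       = λ (x , _) (y , _) → x≤x∨y x y , y≤x∨y x y , λ _ → ∨-least
        ; infimum        = λ (_ , x-sk) (_ , y-sk) → x⊓̄y≤x x-sk , x⊓̄y≤y y-sk
                                                   , λ (_ , z-sk) → ⊓̄-greatest z-sk
        }
      ; maximum = λ _ → maximum _
      ; minimum = λ _ → minimum _
      }
    ; ′-anti  = Δ-anti
    ; ′-invol = proj₂
    ; ′-join  = λ (x , _) → x∨xΔ≈⊤ x
    ; ′-meet  = λ (x , _) → x⊓̄xΔ≈⊥ x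
    }

  S̄→Λ : S̄ L → Λ L
  S̄→Λ (x , _) = Λ[ x ]

  S̄→Λ-isOrthoIso : IsOrthoIso (S̄Sig L S̄-closed) (ΛSig L Λ-closed Λ-join) S̄→Λ
  S̄→Λ-isOrthoIso = record
    { cong       = λ x≈y → ⋆-cong (⟦⟫-cong x≈y)
    ; injective  = λ {x} {y} → injective {x} {y}
    ; surjective = surjective
    ; pres-⊓     = λ (x , _) (y , _) → ≐-sym (⟦⟫⋆-∩ x y)
    ; pres-⊔     = λ (_ , x-sk) (_ , y-sk) → ⋆-cong (⟦⟫-cong (∨-cong (Eq.sym x-sk) (Eq.sym y-sk)))
    ; pres-′     = λ (x , _) → ⋆-cong (⟦⟫-Δ x)
    ; pres-bot   = ≐-sym ｛𝟙｝≐⟦𝟘⟫⋆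
    ; pres-top   = ≐-sym Whole≐⟦𝟙⟫⋆
    }
    where
      open JoinSemilatticeProperties joinSemilattice using (∨-cong)

      injective : ∀ {x y} → ⟦ proj₁ x ⟫ ⋆ ≐ ⟦ proj₁ y ⟫ ⋆ → proj₁ x ≈ proj₁ y
      injective {x , x-sk} {y , y-sk} x↑⋆≐y↑⋆ =
        Eq.trans (Eq.sym x-sk) (Eq.trans (Δ-cong xΔ≈yΔ) y-sk)
        where
          xΔ≈yΔ : x ᐞ ≈ y ᐞ
          xΔ≈yΔ = ⟦⟫-injective (begin
            ⟦ x ᐞ ⟫     ≈⟨ ⟦⟫-Δ x ⟩
            ⟦ x ⟫ ⋆     ≈⟨ x↑⋆≐y↑⋆ ⟩
            ⟦ y ⟫ ⋆     ≈⟨ ⟦⟫-Δ y ⟨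
            ⟦ y ᐞ ⟫     ∎)

      surjective : ∀ F → ∃[ x ] (⟦ proj₁ x ⟫ ⋆ ≐ proj₁ F)
      surjective F = let g = generatorᴧ F in (g ᐞ , Δ-skeletal g) , (begin
        ⟦ g ᐞ ⟫ ⋆       ≈⟨ ⟦⟫-Δ (g ᐞ) ⟨
        ⟦ g ᐞ ᐞ ⟫       ≈⟨ ⟦⟫-cong (generatorᴧ-skeletal F) ⟩
        ⟦ g ⟫           ≈⟨ generatesᴧ F ⟨
        proj₁ F         ∎)

open Defs using (⟦_⟫; _⋆; _∨F_)

theorem3p8 : ∀ {ℓ} (L : WDL ℓ) → let open WDL L in
    -- (1) F_p(L) is a dual weakly complemented lattice ...
    (Σ[ cl ∈ FpClosed L ] IsDualWeaklyComplemented (FpSig L cl))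
    -- ... dually isomorphic to (L; ∨, ∧, Δ, 0, 1) via a ↦ [a)
    × (∀ {a b} → a ≈ b → ⟦_⟫ L a ≐ ⟦_⟫ L b)
    × (∀ {a b} → ⟦_⟫ L a ≐ ⟦_⟫ L b → a ≈ b)
    × (∀ (F : Fp L) → ∃[ a ] (proj₁ F ≐ ⟦_⟫ L a))
    × (∀ a b → ⟦_⟫ L (a ∨ b) ≐ (⟦_⟫ L a ∩ ⟦_⟫ L b))
    × (∀ a b → ⟦_⟫ L (a ∧ b) ≐ _∨F_ L (⟦_⟫ L a) (⟦_⟫ L b))
    × (∀ a → ⟦_⟫ L (a ᐞ) ≐ _⋆ L (⟦_⟫ L a))
    -- (2) Λ(L) is an ortholattice (with the poset join), isomorphic to S̄(L)
    × (Σ[ cl ∈ ΛClosed L ] Σ[ join ∈ (Λ L → Λ L → Λ L) ] Σ[ scl ∈ S̄Closed L ]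
        (IsOrtholattice (ΛSig L cl join)
         × IsOrtholattice (S̄Sig L scl)
         × Σ[ f ∈ (S̄ L → Λ L) ] IsOrthoIso (S̄Sig L scl) (ΛSig L cl join) f))
theorem3p8 L =
    (Fp-closed , Fp-isDualWeaklyComplemented)
  , ⟦⟫-cong
  , ⟦⟫-injective
  , proj₂
  , ⟦⟫-∨
  , ⟦⟫-∧
  , ⟦⟫-Δ
  , (Λ-closed , Λ-join , S̄-closed , Λ-isOrtholattice , S̄-isOrtholattice , S̄→Λ , S̄→Λ-isOrthoIso)
  where open PrincipalFilters L
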